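{- For every integer $r\ge 1$: every finite cross-free hypergraph $H$ all of whose hyperedges have at least $r$ vertices satisfies $\mathsf{p}(H)\ge\lceil r/2\rceil$; and there exists a finite cross-free hypergraph with all hyperedges of size at least $r$ and $\mathsf{p}(H)=\lceil r/2\rceil$.
   Context: A hypergraph $(V,\mathcal{E})$ ($V$ finite, $\mathcal{E}$ a finite multiset of subsets of $V$) is cross-free if for every pair $S,T\in\mathcal{E}$ at least one of $S\cap T$, $S\setminus T$, $T\setminus S$, $V\setminus(S\cup T)$ is empty. A polychromatic $k$-colouring is a map $V\to\{1,\dots,k\}$ such that every hyperedge contains a vertex of every colour; $\mathsf{p}(H)$ is the maximum such $k$. -}

module Defs where

open import Data.Nat.Base using (ℕ; suc; _≤_)
open import Data.Fin.Base using (Fin)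
open import Data.Fin.Subset using (Subset; _∈_; _∩_; _─_; _∪_; ∁; Empty; ∣_∣)
open import Data.List.Base using (List)
open import Data.List.Relation.Unary.All using (All)
open import Data.List.Membership.Propositional using () renaming (_∈_ to _∈ₗ_)
open import Data.Product using (∃; _×_)
open import Data.Sum using (_⊎_)
open import Relation.Binary.PropositionalEquality using (_≡_)
open import Relation.Nullary using (¬_)

-- A finite hypergraph on vertex set V = Fin n; the hyperedges form a finite
-- multiset of subsets of V, represented as a list (repetitions allowed).
record Hypergraph : Set where
  constructor mkHypergraph
  field
    n     : ℕ
    edges : List (Subset n)
open Hypergraph public

NonCrossing : ∀ {n} → Subset n → Subset n → Set
NonCrossing S T = Empty (S ∩ T) ⊎ Empty (S ─ T) ⊎ Empty (T ─ S) ⊎ Empty (∁ (S ∪ T))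

CrossFree : Hypergraph → Set
CrossFree H = ∀ {S T} → S ∈ₗ edges H → T ∈ₗ edges H → NonCrossing S T

MinEdgeSize : ℕ → Hypergraph → Set
MinEdgeSize r H = All (λ S → r ≤ ∣ S ∣) (edges H)

Polychromatic : (H : Hypergraph) (k : ℕ) → (Fin (n H) → Fin k) → Set
Polychromatic H k c = ∀ {S} → S ∈ₗ edges H → ∀ (i : Fin k) → ∃ λ v → v ∈ S × c v ≡ i

HasPolychromatic : Hypergraph → ℕ → Set
HasPolychromatic H k = ∃ λ (c : Fin (n H) → Fin k) → Polychromatic H k c

-- p(H) ≥ k, i.e. the maximum k admitting a polychromatic colouring is at least k
-- (polychromatic colourability is downward closed for k ≥ 1 by merging colours).
pAtLeast : Hypergraph → ℕ → Set
pAtLeast H k = HasPolychromatic H k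

pEquals : Hypergraph → ℕ → Set
pEquals H k = HasPolychromatic H k × ¬ HasPolychromatic H (suc k)

{-# OPTIONS --safe #-}
-- Fix a vertex z and complement every hyperedge that contains z. The complemented family is still
-- cross-free and all its sets avoid z, so any two of them are nested or disjoint. Splitting the other
-- vertices by these sets, largest first, turns each of them into an interval; with z put in front,
-- every hyperedge S is then either an interval or a prefix together with a suffix, and if |S| ≥ r one
-- of the two has at least ⌈ r /2⌉ vertices, because 2 (⌈ r /2⌉ - 1) < r. Colouring the vertices by
-- their position modulo ⌈ r /2⌉ is therefore polychromatic.
-- Conversely, the complements of the singletons of r + 1 vertices are cross-free of size r, and a
-- colouring is polychromatic for them exactly when every colour is used at least twice, which allows
-- ⌊ (r + 1) /2⌋ = ⌈ r /2⌉ colours but not one more.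
module Submission where

open import Data.Bool.Base using (Bool; true; false; not)
open import Data.Empty using (⊥; ⊥-elim)
open import Data.Fin.Base using (Fin; zero; suc; toℕ; fromℕ<)
open import Data.Fin.Properties using (_≟_; toℕ<n; toℕ-fromℕ<; fromℕ<-cong; fromℕ<-toℕ; injective⇒≤; +↔⊎)
open import Data.Fin.Subset using (Subset; _∈_; _∉_; _⊆_; _─_; ∁; ⁅_⁆; ∣_∣; inside; outside)
open import Data.Fin.Subset.Properties
  using (_∈?_; x∈p∩q⁺; x∈p∩q⁻; x∈p∪q⁺; x∈p∪q⁻; x∈p∧x∉q⇒x∈p─q; p─q⊆p; x∉p⇒x∈∁p; x∈∁p⇒x∉p; x∉∁p⇒x∈p; x∈p⇒x∉∁p;
         p⊂q⇒∣p∣<∣q∣; ∣p∣≤n; x∈⁅y⁆⇒x≡y; x≢y⇒x∉⁅y⁆; x∉⁅y⁆⇒x≢y; ∣∁p∣≡n∸∣p∣; ∣⁅x⁆∣≡1)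
open import Data.List.Base using (List; []; _∷_; _++_; filter; length; map; allFin; tabulate)
open import Data.List.Properties using (partition-defn; ++-assoc; ++-identityʳ; filter-++; length-++; filter-all; filter-none; map-tabulate)
open import Data.List.Membership.Propositional using () renaming (_∈_ to _∈ₗ_; _∉_ to _∉ₗ_)
open import Data.List.Membership.Propositional.Properties using (∈-++⁺ʳ; ∈-map⁺; ∈-map⁻; ∈-allFin)
open import Data.List.Relation.Binary.Permutation.Propositional using (_↭_; prep; ↭-refl; ↭-sym; ↭-trans; ↭⇒↭ₛ; ↭ₛ⇒↭)
open import Data.List.Relation.Binary.Permutation.Propositional.Properties using (++⁺; All-resp-↭; ∈-resp-↭; ↭-length; filter-↭)
import Data.List.Relation.Binary.Permutation.Setoid.Properties as Permutationₛ
open import Data.List.Relation.Unary.All as All using (All; []; _∷_)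
open import Data.List.Relation.Unary.All.Properties using (all-filter; map⁺) renaming (++⁺ to ++⁺ᴬ)
open import Data.List.Relation.Unary.AllPairs using (AllPairs; _∷_)
open import Data.List.Relation.Unary.Any using (here; there)
open import Data.List.Relation.Unary.Linked.Properties using (Linked⇒AllPairs)
open import Data.List.Relation.Unary.Unique.Propositional using (Unique)
open import Data.List.Relation.Unary.Unique.Propositional.Properties using (allFin⁺)
import Data.List.Sort as Sort
open import Data.Nat.Base using (ℕ; zero; suc; pred; _+_; _∸_; _≤_; _<_; s≤s; ⌊_/2⌋; ⌈_/2⌉; NonZero; >-nonZero⁻¹)
open import Data.Nat.DivMod using (_%_; _mod_; m%n<n; m<n⇒m%n≡m; [m+n]%n≡m%n)
open import Data.Nat.Properties
  using (≤-refl; ≤-reflexive; ≤-trans; <-trans; ≤-<-trans; <-≤-trans; ≤-pred; _≤?_; ≤⇒≯; <⇒≱; ≰⇒>; <⇒≢; n<1+n; n≤1+n;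
         m≤m+n; m<m+n; +-suc; +-identityʳ; +-mono-≤; +-monoˡ-≤; +-monoʳ-≤; +-monoˡ-<; suc-pred; m≤pred[n]⇒suc[m]≤n;
         ⌈n/2⌉-mono; ⌈n/2⌉≤n; ⌊n/2⌋≤⌈n/2⌉; ⌊n/2⌋+⌈n/2⌉≡n; ≤-decTotalOrder; module ≤-Reasoning)
open import Data.Product using (∃; ∃₂; _×_; _,_; proj₂; uncurry)
open import Data.Sum using (_⊎_; inj₁; inj₂; [_,_]′; reduce)
open import Data.Vec.Base using ([]; _∷_; here; there)
open import Function using (id; _∘_; flip)
open import Function.Bundles using (Injection)
open import Function.Properties.Inverse using (↔⇒↣)
open import Relation.Binary.Bundles using (DecTotalOrder)
import Relation.Binary.Construct.Flip.EqAndOrd as Flip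
import Relation.Binary.Construct.On as On
open import Relation.Binary.Definitions using (DecidableEquality)
open import Relation.Binary.PropositionalEquality
  using (_≡_; _≢_; refl; sym; trans; cong; cong₂; subst; setoid; module ≡-Reasoning)
open import Relation.Nullary using (yes; no; contradiction)
open import Relation.Nullary.Decidable using (decidable-stable)
open import Relation.Unary using (Decidable)
open import Relation.Unary.Properties using (∁?)

open import Defs
x∈p─q⇒x∉q : ∀ {n} {x : Fin n} {p q : Subset n} → x ∈ p ─ q → x ∉ q
x∈p─q⇒x∉q {p = s ∷ p} {inside  ∷ q} (there x∈p─q) (there x∈q) = x∈p─q⇒x∉q x∈p─q x∈q
x∈p─q⇒x∉q {p = inside ∷ p} {outside ∷ q} here ()
x∈p─q⇒x∉q {p = s ∷ p} {outside ∷ q} (there x∈p─q) (there x∈q) = x∈p─q⇒x∉q x∈p─q x∈q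

module _ {n : ℕ} where

  _∈⟨_⟩_ : Fin n → Bool → Subset n → Set
  x ∈⟨ true  ⟩ S = x ∈ S
  x ∈⟨ false ⟩ S = x ∉ S

  Separated : Bool → Bool → Subset n → Subset n → Set
  Separated b c S T = ∀ {x} → x ∈⟨ b ⟩ S → x ∈⟨ c ⟩ T → ⊥

  Disjoint : Subset n → Subset n → Set
  Disjoint A B = ∀ {x} → x ∈ A → x ∉ B

  Laminar : Subset n → Subset n → Set
  Laminar A B = Disjoint A B ⊎ A ⊆ B ⊎ B ⊆ A

  nonCrossing⇒separated : ∀ {S T} → NonCrossing S T → ∃₂ λ b c → Separated b c S T
  nonCrossing⇒separated (inj₁ ∅) = true , true , λ x∈S x∈T → ∅ (_ , x∈p∩q⁺ (x∈S , x∈T))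
  nonCrossing⇒separated (inj₂ (inj₁ ∅)) = true , false , λ x∈S x∉T → ∅ (_ , x∈p∧x∉q⇒x∈p─q x∈S x∉T)
  nonCrossing⇒separated (inj₂ (inj₂ (inj₁ ∅))) = false , true , λ x∉S x∈T → ∅ (_ , x∈p∧x∉q⇒x∈p─q x∈T x∉S)
  nonCrossing⇒separated {S} {T} (inj₂ (inj₂ (inj₂ ∅))) = false , false ,
    λ x∉S x∉T → ∅ (_ , x∉p⇒x∈∁p (λ x∈S∪T → [ x∉S , x∉T ]′ (x∈p∪q⁻ S T x∈S∪T)))

  separated⇒nonCrossing : ∀ b c {S T} → Separated b c S T → NonCrossing S T
  separated⇒nonCrossing true  true  {S} {T} sep = inj₁ λ (_ , x∈S∩T) → uncurry sep (x∈p∩q⁻ S T x∈S∩T)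
  separated⇒nonCrossing true  false {S} {T} sep = inj₂ (inj₁ λ (_ , x∈S─T) → sep (p─q⊆p S T x∈S─T) (x∈p─q⇒x∉q x∈S─T))
  separated⇒nonCrossing false true  {S} {T} sep = inj₂ (inj₂ (inj₁ λ (_ , x∈T─S) → sep (x∈p─q⇒x∉q x∈T─S) (p─q⊆p T S x∈T─S)))
  separated⇒nonCrossing false false {S} {T} sep = inj₂ (inj₂ (inj₂ λ (_ , x∉S∪T) →
    sep (λ x∈S → x∈∁p⇒x∉p x∉S∪T (x∈p∪q⁺ (inj₁ x∈S))) (λ x∈T → x∈∁p⇒x∉p x∉S∪T (x∈p∪q⁺ (inj₂ x∈T)))))

  ∈⟨not⟩∁⇒∈⟨⟩ : ∀ b {x} {S : Subset n} → x ∈⟨ not b ⟩ ∁ S → x ∈⟨ b ⟩ S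
  ∈⟨not⟩∁⇒∈⟨⟩ true  = x∉∁p⇒x∈p
  ∈⟨not⟩∁⇒∈⟨⟩ false = x∈∁p⇒x∉p

  separated-∁ˡ : ∀ {b c S T} → Separated b c S T → Separated (not b) c (∁ S) T
  separated-∁ˡ {b} sep x∈∁S = sep (∈⟨not⟩∁⇒∈⟨⟩ b x∈∁S)

  separated-∁ʳ : ∀ {b c S T} → Separated b c S T → Separated b (not c) S (∁ T)
  separated-∁ʳ {c = c} sep x∈S x∈∁T = sep x∈S (∈⟨not⟩∁⇒∈⟨⟩ c x∈∁T)

  avoid : Fin n → Subset n → Subset n
  avoid z S with z ∈? S
  ... | yes _ = ∁ S
  ... | no  _ = S

  z∉avoid : ∀ z S → z ∉ avoid z S
  z∉avoid z S with z ∈? S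
  ... | yes z∈S = x∈p⇒x∉∁p z∈S
  ... | no  z∉S = z∉S

  separated-avoid : ∀ z {b c S T} → Separated b c S T → ∃₂ λ b′ c′ → Separated b′ c′ (avoid z S) (avoid z T)
  separated-avoid z {S = S} {T} sep with z ∈? S | z ∈? T
  ... | yes _ | yes _ = _ , _ , separated-∁ʳ (separated-∁ˡ sep)
  ... | yes _ | no  _ = _ , _ , separated-∁ˡ sep
  ... | no  _ | yes _ = _ , _ , separated-∁ʳ sep
  ... | no  _ | no  _ = _ , _ , sep

  separated⇒laminar : ∀ {z b c S T} → z ∉ S → z ∉ T → Separated b c S T → Laminar S T
  separated⇒laminar {b = true}  {true}  _ _ sep = inj₁ sep
  separated⇒laminar {b = true}  {false} {T = T} _ _ sep = inj₂ (inj₁ λ {x} x∈S → decidable-stable (x ∈? T) (sep x∈S))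
  separated⇒laminar {b = false} {true}  {S} _ _ sep = inj₂ (inj₂ λ {x} x∈T → decidable-stable (x ∈? S) (flip sep x∈T))
  separated⇒laminar {b = false} {false} z∉S z∉T sep = ⊥-elim (sep z∉S z∉T)

  avoid-laminar : ∀ z {S T} → NonCrossing S T → Laminar (avoid z S) (avoid z T)
  avoid-laminar z {S} {T} nc =
    let _ , _ , sep = separated-avoid z (proj₂ (proj₂ (nonCrossing⇒separated nc)))
    in separated⇒laminar (z∉avoid z S) (z∉avoid z T) sep

  p⊆q∧∣q∣≤∣p∣⇒q⊆p : ∀ {p q : Subset n} → p ⊆ q → ∣ q ∣ ≤ ∣ p ∣ → q ⊆ p
  p⊆q∧∣q∣≤∣p∣⇒q⊆p {p} p⊆q ∣q∣≤∣p∣ {x} x∈q with x ∈? p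
  ... | yes x∈p = x∈p
  ... | no  x∉p = ⊥-elim (≤⇒≯ ∣q∣≤∣p∣ (p⊂q⇒∣p∣<∣q∣ (p⊆q , x , x∈q , x∉p)))

  laminar⇒⊆⊎disjoint : ∀ {A B} → ∣ B ∣ ≤ ∣ A ∣ → Laminar A B → B ⊆ A ⊎ Disjoint A B
  laminar⇒⊆⊎disjoint _     (inj₁ disjoint)    = inj₂ disjoint
  laminar⇒⊆⊎disjoint ∣B∣≤∣A∣ (inj₂ (inj₁ A⊆B)) = inj₁ (p⊆q∧∣q∣≤∣p∣⇒q⊆p A⊆B ∣B∣≤∣A∣)
  laminar⇒⊆⊎disjoint _     (inj₂ (inj₂ B⊆A)) = inj₁ B⊆A

module _ {A : Set} where

  filter-split-↭ : ∀ {P : A → Set} (P? : Decidable P) xs → xs ↭ filter P? xs ++ filter (∁? P?) xs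
  filter-split-↭ P? xs =
    subst (λ (ys , zs) → xs ↭ ys ++ zs) (partition-defn P? xs) (↭ₛ⇒↭ (Permutationₛ.partition-↭ (setoid A) P? xs))

  unique-↭ : ∀ {xs ys : List A} → xs ↭ ys → Unique xs → Unique ys
  unique-↭ xs↭ys = Permutationₛ.Unique-resp-↭ (setoid A) (↭⇒↭ₛ xs↭ys)

module _ {n : ℕ} where

  arrange : List (Subset n) → List (Fin n) → List (Fin n)
  arrange []       U = U
  arrange (A ∷ As) U = arrange As (filter (_∈? A) U) ++ arrange As (filter (∁? (_∈? A)) U)

  arrange-↭ : ∀ As U → arrange As U ↭ U
  arrange-↭ []       U = ↭-refl
  arrange-↭ (A ∷ As) U =
    ↭-trans (++⁺ (arrange-↭ As _) (arrange-↭ As _)) (↭-sym (filter-split-↭ (_∈? A) U))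

  arrange-all : ∀ {P : Fin n → Set} As {U} → All P U → All P (arrange As U)
  arrange-all As = All-resp-↭ (↭-sym (arrange-↭ As _))

  record Interval (B : Subset n) (L : List (Fin n)) : Set where
    constructor interval
    field
      before within after : List (Fin n)
      split     : L ≡ before ++ within ++ after
      before∉B  : All (_∉ B) before
      within∈B  : All (_∈ B) within
      after∉B   : All (_∉ B) after

  arrange-interval : ∀ {B} As → B ∈ₗ As → AllPairs (λ A A′ → ∣ A′ ∣ ≤ ∣ A ∣) As →
                     All (λ A → Laminar A B) As → ∀ U → Interval B (arrange As U)
  arrange-interval (B ∷ As) (here refl) _ _ U =
    interval [] _ _ refl [] (arrange-all As (all-filter (_∈? B) U)) (arrange-all As (all-filter (∁? (_∈? B)) U))
  arrange-interval {B} (A ∷ As) (there B∈As) (As≤A ∷ sorted) (lam ∷ lams) U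
    with laminar⇒⊆⊎disjoint (All.lookup As≤A B∈As) lam
  ... | inj₁ B⊆A =
    let interval X Y Z L≡XYZ X∉B Y∈B Z∉B = arrange-interval As B∈As sorted lams (filter (_∈? A) U)
        rest = arrange As (filter (∁? (_∈? A)) U)
    in interval X Y (Z ++ rest)
         (trans (cong (_++ rest) L≡XYZ) (trans (++-assoc X _ rest) (cong (X ++_) (++-assoc Y Z rest))))
         X∉B Y∈B (++⁺ᴬ Z∉B (All.map (_∘ B⊆A) (arrange-all As (all-filter (∁? (_∈? A)) U))))
  ... | inj₂ A∩B=∅ =
    let interval X Y Z L≡XYZ X∉B Y∈B Z∉B = arrange-interval As B∈As sorted lams (filter (∁? (_∈? A)) U)
        inA = arrange As (filter (_∈? A) U)
    in interval (inA ++ X) Y Z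
         (trans (cong (inA ++_) L≡XYZ) (sym (++-assoc inA X _)))
         (++⁺ᴬ (All.map A∩B=∅ (arrange-all As (all-filter (_∈? A) U))) X∉B) Y∈B Z∉B

countIn : ∀ {n} → Subset n → List (Fin n) → ℕ
countIn S xs = length (filter (_∈? S) xs)

module _ {n : ℕ} (S : Subset n) where

  countIn-++ : ∀ xs ys → countIn S (xs ++ ys) ≡ countIn S xs + countIn S ys
  countIn-++ xs ys = trans (cong length (filter-++ (_∈? S) xs ys)) (length-++ (filter (_∈? S) xs))

  countIn-all : ∀ {xs} → All (_∈ S) xs → countIn S xs ≡ length xs
  countIn-all xs∈S = cong length (filter-all (_∈? S) xs∈S)

  countIn-none : ∀ {xs} → All (_∉ S) xs → countIn S xs ≡ 0
  countIn-none xs∉S = cong length (filter-none (_∈? S) xs∉S)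

  countIn-blocks : ∀ xs ys zs → countIn S (xs ++ ys ++ zs) ≡ countIn S xs + (countIn S ys + countIn S zs)
  countIn-blocks xs ys zs = trans (countIn-++ xs _) (cong (countIn S xs +_) (countIn-++ ys zs))

  countIn-↭ : ∀ {xs ys} → xs ↭ ys → countIn S xs ≡ countIn S ys
  countIn-↭ xs↭ys = ↭-length (filter-↭ (_∈? S) xs↭ys)

countIn-map-suc : ∀ {n} s (S : Subset n) xs → countIn (s ∷ S) (map suc xs) ≡ countIn S xs
countIn-map-suc s S []       = refl
countIn-map-suc s S (x ∷ xs) with x ∈? S
... | yes _ = cong suc (countIn-map-suc s S xs)
... | no  _ = countIn-map-suc s S xs

countIn-tabulate-suc : ∀ {n} s (S : Subset n) → countIn (s ∷ S) (tabulate suc) ≡ countIn S (allFin n)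
countIn-tabulate-suc {n} s S = trans (cong (countIn (s ∷ S)) (sym (map-tabulate id suc))) (countIn-map-suc s S (allFin n))

countIn-allFin : ∀ {n} (S : Subset n) → countIn S (allFin n) ≡ ∣ S ∣
countIn-allFin []            = refl
countIn-allFin (inside  ∷ S) = cong suc (trans (countIn-tabulate-suc inside S) (countIn-allFin S))
countIn-allFin (outside ∷ S) = trans (countIn-tabulate-suc outside S) (countIn-allFin S)

∣p∣≡countIn : ∀ {n} (S : Subset n) {L} → L ↭ allFin n → ∣ S ∣ ≡ countIn S L
∣p∣≡countIn S L↭ = sym (trans (countIn-↭ S L↭) (countIn-allFin S))

%⇒mod : ∀ {k} .{{_ : NonZero k}} {a b} → a % k ≡ b % k → a mod k ≡ b mod k
%⇒mod {k} eq = fromℕ<-cong _ _ eq (m%n<n _ k) (m%n<n _ k)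

toℕ-mod : ∀ {k} .{{_ : NonZero k}} (i : Fin k) → toℕ i mod k ≡ i
toℕ-mod {k} i = trans (fromℕ<-cong _ _ (m<n⇒m%n≡m (toℕ<n i)) (m%n<n _ k) (toℕ<n i)) (fromℕ<-toℕ i (toℕ<n i))

window-residue : ∀ {k} .{{_ : NonZero k}} a (i : Fin k) → ∃ λ j → j < k × (a + j) mod k ≡ i
window-residue zero i = toℕ i , toℕ<n i , toℕ-mod i
window-residue {k} (suc a) i with window-residue a i
... | zero , _ , a≡i = pred k , m≤pred[n]⇒suc[m]≤n ≤-refl ,
  trans (cong (_mod k) (trans (sym (+-suc a (pred k))) (cong (a +_) (suc-pred k))))
        (trans (%⇒mod ([m+n]%n≡m%n a k)) (trans (cong (_mod k) (sym (+-identityʳ a))) a≡i))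
... | suc j , j<k , a+j≡i = j , <-trans (n<1+n j) j<k , trans (cong (_mod k) (sym (+-suc a j))) a+j≡i

module _ {A : Set} where

  LongBlock : ℕ → (A → Set) → List A → Set
  LongBlock k P L = ∃₂ λ B Q → ∃ λ R → L ≡ B ++ Q ++ R × All P Q × k ≤ length Q

  split-at : ∀ (Q : List A) j → j < length Q → ∃₂ λ Q₁ v → ∃ λ Q₂ → Q ≡ Q₁ ++ v ∷ Q₂ × length Q₁ ≡ j
  split-at (v ∷ Q) zero    _         = [] , v , Q , refl , refl
  split-at (x ∷ Q) (suc j) (s≤s j<Q) =
    let Q₁ , v , Q₂ , Q≡ , ∣Q₁∣≡j = split-at Q j j<Q in x ∷ Q₁ , v , Q₂ , cong (x ∷_) Q≡ , cong suc ∣Q₁∣≡j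

  unique-++-∷⇒∉ : ∀ W {v : A} {T} → Unique (W ++ v ∷ T) → v ∉ₗ W
  unique-++-∷⇒∉ (x ∷ W) (x≢ ∷ _) (here refl) = All.lookup x≢ (∈-++⁺ʳ W (here refl)) refl
  unique-++-∷⇒∉ (x ∷ W) (_ ∷ u)  (there v∈W) = unique-++-∷⇒∉ W u v∈W

module _ {A : Set} (_≟_ : DecidableEquality A) where

  -- The first index of v, and the length of the list when v does not occur.
  position : A → List A → ℕ
  position v [] = 0
  position v (x ∷ xs) with v ≟ x
  ... | yes _ = 0
  ... | no  _ = suc (position v xs)

  position-++-∷ : ∀ {v} W {T} → v ∉ₗ W → position v (W ++ v ∷ T) ≡ length W
  position-++-∷ {v} [] _ with v ≟ v
  ... | yes _   = refl
  ... | no  v≢v = ⊥-elim (v≢v refl)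
  position-++-∷ {v} (x ∷ W) v∉x∷W with v ≟ x
  ... | yes v≡x = ⊥-elim (v∉x∷W (here v≡x))
  ... | no  _   = cong suc (position-++-∷ W (v∉x∷W ∘ there))

  longBlock-rainbow : ∀ {k} .{{_ : NonZero k}} {P : A → Set} {L} → Unique L → LongBlock k P L →
                      ∀ (i : Fin k) → ∃ λ v → P v × position v L mod k ≡ i
  longBlock-rainbow {k} {L = L} unique (B , Q , R , L≡BQR , Q∈P , k≤∣Q∣) i =
    let j , j<k , B+j≡i = window-residue (length B) i
        Q₁ , v , Q₂ , Q≡ , ∣Q₁∣≡j = split-at Q j (<-≤-trans j<k k≤∣Q∣)
        L≡ : L ≡ (B ++ Q₁) ++ v ∷ (Q₂ ++ R)
        L≡ = trans L≡BQR (trans (cong (λ Q → B ++ Q ++ R) Q≡)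
                (trans (cong (B ++_) (++-assoc Q₁ (v ∷ Q₂) R)) (sym (++-assoc B Q₁ _))))
        position≡ : position v L ≡ length B + j
        position≡ = trans (cong (position v) L≡)
          (trans (position-++-∷ (B ++ Q₁) (unique-++-∷⇒∉ (B ++ Q₁) (subst Unique L≡ unique)))
                 (trans (length-++ B) (cong (length B +_) ∣Q₁∣≡j)))
    in v , All.lookup Q∈P (subst (v ∈ₗ_) (sym Q≡) (∈-++⁺ʳ Q₁ (here refl))) , trans (cong (_mod k) position≡) B+j≡i

⌈n/2⌉+⌈n/2⌉≤1+n : ∀ n → ⌈ n /2⌉ + ⌈ n /2⌉ ≤ suc n
⌈n/2⌉+⌈n/2⌉≤1+n n = begin
  ⌈ n /2⌉ + ⌈ n /2⌉         ≤⟨ +-monoʳ-≤ ⌈ n /2⌉ (⌈n/2⌉-mono (n≤1+n n)) ⟩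
  ⌊ suc n /2⌋ + ⌈ suc n /2⌉ ≡⟨ ⌊n/2⌋+⌈n/2⌉≡n (suc n) ⟩
  suc n                     ∎
  where open ≤-Reasoning

<⌈n/2⌉⇒+<n : ∀ {n a b} → a < ⌈ n /2⌉ → b < ⌈ n /2⌉ → a + b < n
<⌈n/2⌉⇒+<n {n} {a} {b} a<k b<k = ≤-pred (begin
  suc (suc (a + b)) ≡⟨ sym (+-suc (suc a) b) ⟩
  suc a + suc b     ≤⟨ +-mono-≤ a<k b<k ⟩
  ⌈ n /2⌉ + ⌈ n /2⌉ ≤⟨ ⌈n/2⌉+⌈n/2⌉≤1+n n ⟩
  suc n             ∎)
  where open ≤-Reasoning

1+n<2+⌈n/2⌉+⌈n/2⌉ : ∀ n → suc n < suc ⌈ n /2⌉ + suc ⌈ n /2⌉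
1+n<2+⌈n/2⌉+⌈n/2⌉ n = s≤s (begin
  suc n                       ≡⟨ cong suc (sym (⌊n/2⌋+⌈n/2⌉≡n n)) ⟩
  suc (⌊ n /2⌋ + ⌈ n /2⌉)     ≤⟨ s≤s (+-monoˡ-≤ ⌈ n /2⌉ (⌊n/2⌋≤⌈n/2⌉ n)) ⟩
  suc (⌈ n /2⌉ + ⌈ n /2⌉)     ≡⟨ sym (+-suc ⌈ n /2⌉ ⌈ n /2⌉) ⟩
  ⌈ n /2⌉ + suc ⌈ n /2⌉       ∎)
  where open ≤-Reasoning

bySizeDecreasing : ∀ n → DecTotalOrder _ _ _
bySizeDecreasing n = On.decTotalOrder (Flip.decTotalOrder ≤-decTotalOrder) (∣_∣ {n})

module _ {m : ℕ} where
  open Sort (bySizeDecreasing (suc m)) using (sort; sort-↭; sort-↗)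

  orderAvoidingZero : List (Subset (suc m)) → List (Fin (suc m))
  orderAvoidingZero es = arrange (sort (map (avoid zero) es)) (tabulate suc)

  orderAvoidingZero-↭ : ∀ es → zero ∷ orderAvoidingZero es ↭ allFin (suc m)
  orderAvoidingZero-↭ es = prep zero (arrange-↭ (sort (map (avoid zero) es)) (tabulate suc))

  orderAvoidingZero-interval : ∀ {es S} → CrossFree (mkHypergraph (suc m) es) → S ∈ₗ es →
                               Interval (avoid zero S) (orderAvoidingZero es)
  orderAvoidingZero-interval {es} {S} cf S∈es =
    arrange-interval (sort Es) (∈-resp-↭ (↭-sym (sort-↭ Es)) (∈-map⁺ (avoid zero) S∈es))
      (Linked⇒AllPairs (flip ≤-trans) (sort-↗ Es)) (All-resp-↭ (↭-sym (sort-↭ Es)) laminar) (tabulate suc)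
    where
    Es = map (avoid zero) es
    laminar : All (λ A → Laminar A (avoid zero S)) Es
    laminar = map⁺ (All.tabulate λ T∈es → avoid-laminar zero (cf T∈es S∈es))

  interval-longBlock : ∀ {r L S} → zero ∷ L ↭ allFin (suc m) → zero ∉ S → Interval S L → r ≤ ∣ S ∣ →
                       LongBlock ⌈ r /2⌉ (_∈ S) (zero ∷ L)
  interval-longBlock {r} {L} {S} L↭ z∉S (interval X Y Z refl X∉S Y∈S Z∉S) r≤∣S∣ =
    zero ∷ X , Y , Z , refl , Y∈S , ≤-trans (⌈n/2⌉≤n r) (≤-trans r≤∣S∣ (≤-reflexive ∣S∣≡∣Y∣))
    where
    ∣S∣≡∣Y∣ : ∣ S ∣ ≡ length Y
    ∣S∣≡∣Y∣ = begin
      ∣ S ∣                                               ≡⟨ ∣p∣≡countIn S L↭ ⟩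
      countIn S ((zero ∷ X) ++ Y ++ Z)                    ≡⟨ countIn-blocks S (zero ∷ X) Y Z ⟩
      countIn S (zero ∷ X) + (countIn S Y + countIn S Z)  ≡⟨ cong₂ _+_ (countIn-none S (z∉S ∷ X∉S))
                                                             (cong₂ _+_ (countIn-all S Y∈S) (countIn-none S Z∉S)) ⟩
      length Y + 0                                        ≡⟨ +-identityʳ (length Y) ⟩
      length Y                                            ∎
      where open ≡-Reasoning

  coInterval-longBlock : ∀ {r L S} → zero ∷ L ↭ allFin (suc m) → zero ∈ S → Interval (∁ S) L → r ≤ ∣ S ∣ →
                         LongBlock ⌈ r /2⌉ (_∈ S) (zero ∷ L)
  coInterval-longBlock {r} {L} {S} L↭ z∈S (interval X Y Z refl X∉∁S Y∈∁S Z∉∁S) r≤∣S∣ =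
    prefix-or-suffix (≤-trans r≤∣S∣ (≤-reflexive ∣S∣≡))
    where
    X∈S = All.map x∉∁p⇒x∈p X∉∁S
    Z∈S = All.map x∉∁p⇒x∈p Z∉∁S
    Y∉S = All.map x∈∁p⇒x∉p Y∈∁S
    ∣S∣≡ : ∣ S ∣ ≡ suc (length X) + length Z
    ∣S∣≡ = begin
      ∣ S ∣                                               ≡⟨ ∣p∣≡countIn S L↭ ⟩
      countIn S ((zero ∷ X) ++ Y ++ Z)                    ≡⟨ countIn-blocks S (zero ∷ X) Y Z ⟩
      countIn S (zero ∷ X) + (countIn S Y + countIn S Z)  ≡⟨ cong₂ _+_ (countIn-all S (z∈S ∷ X∈S))
                                                             (cong₂ _+_ (countIn-none S Y∉S) (countIn-all S Z∈S)) ⟩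
      suc (length X) + length Z                           ∎
      where open ≡-Reasoning
    prefix-or-suffix : r ≤ suc (length X) + length Z → LongBlock ⌈ r /2⌉ (_∈ S) (zero ∷ L)
    prefix-or-suffix r≤∣S∣ with ⌈ r /2⌉ ≤? suc (length X) | ⌈ r /2⌉ ≤? length Z
    ... | yes k≤∣zX∣ | _ = [] , zero ∷ X , Y ++ Z , refl , z∈S ∷ X∈S , k≤∣zX∣
    ... | no _ | yes k≤∣Z∣ = zero ∷ X ++ Y , Z , [] , L′≡ , Z∈S , k≤∣Z∣
      where
      L′≡ : zero ∷ L ≡ (zero ∷ X ++ Y) ++ Z ++ []
      L′≡ = cong (zero ∷_) (trans (sym (++-assoc X Y Z)) (cong ((X ++ Y) ++_) (sym (++-identityʳ Z))))
    ... | no k≰∣zX∣ | no k≰∣Z∣ = ⊥-elim (<⇒≱ (<⌈n/2⌉⇒+<n (≰⇒> k≰∣zX∣) (≰⇒> k≰∣Z∣)) r≤∣S∣)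

  avoidZero-longBlock : ∀ {r L S} → zero ∷ L ↭ allFin (suc m) → Interval (avoid zero S) L → r ≤ ∣ S ∣ →
               LongBlock ⌈ r /2⌉ (_∈ S) (zero ∷ L)
  avoidZero-longBlock {S = S} L↭ I r≤∣S∣ with zero ∈? S
  ... | yes z∈S = coInterval-longBlock L↭ z∈S I r≤∣S∣
  ... | no  z∉S = interval-longBlock L↭ z∉S I r≤∣S∣

lowerBound : ∀ r (H : Hypergraph) → CrossFree H → MinEdgeSize (suc r) H → pAtLeast H ⌈ suc r /2⌉
lowerBound r (mkHypergraph zero es) _ large =
  (λ ()) , λ {S} S∈es → contradiction (≤-trans (All.lookup large S∈es) (∣p∣≤n S)) λ ()
lowerBound r (mkHypergraph (suc m) es) cf large = colour , λ S∈es →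
  longBlock-rainbow _≟_ (unique-↭ (↭-sym L↭) (allFin⁺ (suc m)))
    (avoidZero-longBlock L↭ (orderAvoidingZero-interval cf S∈es) (All.lookup large S∈es))
  where
  L↭ = orderAvoidingZero-↭ es
  colour : Fin (suc m) → Fin ⌈ suc r /2⌉
  colour v = position _≟_ v (zero ∷ orderAvoidingZero es) mod ⌈ suc r /2⌉

coSingletons : ℕ → Hypergraph
coSingletons n = mkHypergraph n (map (λ i → ∁ ⁅ i ⁆) (allFin n))

module _ {n : ℕ} where

  ∁⁅⁆∈coSingletons : ∀ (i : Fin n) → ∁ ⁅ i ⁆ ∈ₗ edges (coSingletons n)
  ∁⁅⁆∈coSingletons i = ∈-map⁺ (λ i → ∁ ⁅ i ⁆) (∈-allFin i)

  coSingletons-edge : ∀ {S} → S ∈ₗ edges (coSingletons n) → ∃ λ i → S ≡ ∁ ⁅ i ⁆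
  coSingletons-edge S∈ = let i , _ , S≡ = ∈-map⁻ (λ i → ∁ ⁅ i ⁆) S∈ in i , S≡

  x≢y⇒x∈∁⁅y⁆ : ∀ {x y : Fin n} → x ≢ y → x ∈ ∁ ⁅ y ⁆
  x≢y⇒x∈∁⁅y⁆ = x∉p⇒x∈∁p ∘ x≢y⇒x∉⁅y⁆

  x∈∁⁅y⁆⇒x≢y : ∀ {x y : Fin n} → x ∈ ∁ ⁅ y ⁆ → x ≢ y
  x∈∁⁅y⁆⇒x≢y = x∉⁅y⁆⇒x≢y ∘ x∈∁p⇒x∉p

  x∉∁⁅y⁆⇒x≡y : ∀ {x} (y : Fin n) → x ∉ ∁ ⁅ y ⁆ → x ≡ y
  x∉∁⁅y⁆⇒x≡y y = x∈⁅y⁆⇒x≡y y ∘ x∉∁p⇒x∈p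

  coSingletons-crossFree : CrossFree (coSingletons n)
  coSingletons-crossFree S∈ T∈ with coSingletons-edge S∈ | coSingletons-edge T∈
  ... | i , refl | j , refl with i ≟ j
  ...   | yes refl = separated⇒nonCrossing true false λ x∈ x∉ → x∉ x∈
  ...   | no  i≢j  = separated⇒nonCrossing false false λ {x} x∉∁i x∉∁j →
    i≢j (trans (sym (x∉∁⁅y⁆⇒x≡y i x∉∁i)) (x∉∁⁅y⁆⇒x≡y j x∉∁j))

coSingletons-size : ∀ n → MinEdgeSize n (coSingletons (suc n))
coSingletons-size n = map⁺ (All.universal ∣∁⁅i⁆∣≥n (allFin (suc n)))
  where
  ∣∁⁅i⁆∣≥n : ∀ i → n ≤ ∣ ∁ ⁅ i ⁆ ∣
  ∣∁⁅i⁆∣≥n i = ≤-reflexive (sym (trans (∣∁p∣≡n∸∣p∣ ⁅ i ⁆) (cong (suc n ∸_) (∣⁅x⁆∣≡1 i))))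

record TwoOfColour {n k} (c : Fin n → Fin k) (t : Fin k) : Set where
  constructor twoOfColour
  field
    first second : Fin n
    distinct     : first ≢ second
    first-colour : c first ≡ t
    second-colour : c second ≡ t

EveryColourTwice : ∀ {n k} → (Fin n → Fin k) → Set
EveryColourTwice c = ∀ t → TwoOfColour c t

module _ {n k} {c : Fin n → Fin k} where

  twoOfColour-meets-∁⁅⁆ : ∀ {t} → TwoOfColour c t → ∀ i → ∃ λ v → v ∈ ∁ ⁅ i ⁆ × c v ≡ t
  twoOfColour-meets-∁⁅⁆ (twoOfColour u w u≢w cu≡t cw≡t) i with u ≟ i
  ... | yes refl = w , x≢y⇒x∈∁⁅y⁆ (u≢w ∘ sym) , cw≡t
  ... | no  u≢i  = u , x≢y⇒x∈∁⁅y⁆ u≢i , cu≡t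

  twice⇒polychromatic : EveryColourTwice c → Polychromatic (coSingletons n) k c
  twice⇒polychromatic twice S∈ t with coSingletons-edge S∈
  ... | i , refl = twoOfColour-meets-∁⁅⁆ (twice t) i

  twice⇒+≤ : EveryColourTwice c → k + k ≤ n
  twice⇒+≤ twice = injective⇒≤ (Injection.injective (↔⇒↣ (+↔⊎ {k} {k})) ∘ pick-injective)
    where
    pick : Fin k ⊎ Fin k → Fin n
    pick (inj₁ t) = TwoOfColour.first (twice t)
    pick (inj₂ t) = TwoOfColour.second (twice t)
    colour-pick : ∀ p → c (pick p) ≡ reduce p
    colour-pick (inj₁ t) = TwoOfColour.first-colour (twice t)
    colour-pick (inj₂ t) = TwoOfColour.second-colour (twice t)
    same-colour : ∀ p q → pick p ≡ pick q → reduce p ≡ reduce q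
    same-colour p q eq = trans (sym (colour-pick p)) (trans (cong c eq) (colour-pick q))
    pick-injective : ∀ {p q} → pick p ≡ pick q → p ≡ q
    pick-injective {inj₁ t} {inj₁ t′} eq = cong inj₁ (same-colour (inj₁ t) (inj₁ t′) eq)
    pick-injective {inj₂ t} {inj₂ t′} eq = cong inj₂ (same-colour (inj₂ t) (inj₂ t′) eq)
    pick-injective {inj₁ t} {inj₂ t′} eq with refl ← same-colour (inj₁ t) (inj₂ t′) eq =
      ⊥-elim (TwoOfColour.distinct (twice t) eq)
    pick-injective {inj₂ t} {inj₁ t′} eq with refl ← same-colour (inj₂ t) (inj₁ t′) eq =
      ⊥-elim (TwoOfColour.distinct (twice t) (sym eq))

polychromatic⇒twice : ∀ {n k} {c : Fin (suc n) → Fin k} → Polychromatic (coSingletons (suc n)) k c → EveryColourTwice c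
polychromatic⇒twice poly t =
  let u , _ , cu≡t = poly (∁⁅⁆∈coSingletons zero) t
      w , w∈∁⁅u⁆ , cw≡t = poly (∁⁅⁆∈coSingletons u) t
  in twoOfColour u w (λ u≡w → x∈∁⁅y⁆⇒x≢y w∈∁⁅u⁆ (sym u≡w)) cu≡t cw≡t

-- Colour t is used by the vertices t and t + k.
mod-twice : ∀ {n k} .{{_ : NonZero k}} → k + k ≤ n → EveryColourTwice {n} (λ v → toℕ v mod k)
mod-twice {n} {k} k+k≤n t = twoOfColour (fromℕ< t<n) (fromℕ< t+k<n) distinct
  (trans (cong (_mod k) (toℕ-fromℕ< t<n)) (toℕ-mod t))
  (trans (cong (_mod k) (toℕ-fromℕ< t+k<n)) (trans (%⇒mod ([m+n]%n≡m%n (toℕ t) k)) (toℕ-mod t)))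
  where
  t+k<n : toℕ t + k < n
  t+k<n = <-≤-trans (+-monoˡ-< k (toℕ<n t)) k+k≤n
  t<n : toℕ t < n
  t<n = ≤-<-trans (m≤m+n (toℕ t) k) t+k<n
  distinct : fromℕ< t<n ≢ fromℕ< t+k<n
  distinct eq = <⇒≢ (m<m+n (toℕ t) (>-nonZero⁻¹ k))
    (trans (sym (toℕ-fromℕ< t<n)) (trans (cong toℕ eq) (toℕ-fromℕ< t+k<n)))

coSingletons-pEquals : ∀ r → pEquals (coSingletons (suc (suc r))) ⌈ suc r /2⌉
coSingletons-pEquals r =
  ((λ v → toℕ v mod ⌈ suc r /2⌉) , twice⇒polychromatic (mod-twice (⌈n/2⌉+⌈n/2⌉≤1+n (suc r)))) ,
  λ (_ , poly) → <⇒≱ (1+n<2+⌈n/2⌉+⌈n/2⌉ (suc r)) (twice⇒+≤ (polychromatic⇒twice poly))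

proposition6 : ∀ (r : ℕ) → 1 ≤ r →
    ((H : Hypergraph) → CrossFree H → MinEdgeSize r H → pAtLeast H ⌈ r /2⌉)
    × (∃ λ (H : Hypergraph) → CrossFree H × MinEdgeSize r H × pEquals H ⌈ r /2⌉)
proposition6 (suc r) _ =
  lowerBound r ,
  (coSingletons (suc (suc r)) , coSingletons-crossFree , coSingletons-size (suc r) , coSingletons-pEquals r)
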